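{- Let $G_0$ be a connected graph with an edge $e=\{v_1,v_2\}$, $s$ a non-leaping sequence, and $G\in\mathrm{CP}(s)$. For $x\in V(G_0)\setminus\{v_1,v_2\}$ and $k\in V(G)$ with $k\ge 4$, if $k$ is adjacent to both $1$ and $2$, then $\operatorname{dist}_{G_0\oplus_eG}(x,k)=\operatorname{dist}_{G_0\oplus_eG}(x,k-1)$.
   Context: A sequence of integers $q_1,\ldots,q_n$ ($n\ge 2$) is non-leaping if $q_1=0$, $q_2=1$, and $2\le q_k\le q_{k-1}+1$ for $k=3,\ldots,n$. Set $b_k=k-q_k+1$ for $k\ge 3$. A neighborhood sequence is $W_1=\varnothing$, $W_2=\{1\}$, and for $k\ge3$, $W_k=\{a_k\}\cup\{b_k,\ldots,k-1\}$ where $a_k\in W_{k-1}$ and $a_k<b_k$. Its graph has vertex set $\{1,\ldots,n\}$ and edges $\{i,k\}$ for $i\in W_k$; $\mathrm{CP}(s)$ is the set of all such graphs. $G_0\oplus_eG$ is obtained from the disjoint union of $G_0$ and $G$ by identifying $v_1$ with vertex $1$ and $v_2$ with vertex $2$. -}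

module Defs where

open import Data.Nat using (ℕ; zero; suc; _+_; _∸_; _≤_; _<_)
open import Data.Fin using (Fin)
open import Data.Sum using (_⊎_; inj₁; inj₂)
open import Data.Product using (Σ; _×_; ∃)
open import Data.Empty using (⊥)
open import Relation.Nullary using (¬_)
open import Relation.Binary.PropositionalEquality using (_≡_)

record SimpleGraph (m : ℕ) : Set₁ where
  field
    Adj     : Fin m → Fin m → Set
    sym     : ∀ {x y} → Adj x y → Adj y x
    irrefl  : ∀ {x} → ¬ Adj x x

data Walk {V : Set} (R : V → V → Set) : V → V → ℕ → Set where
  []  : ∀ {u} → Walk R u u 0
  _∷_ : ∀ {u v w d} → R u v → Walk R v w d → Walk R u w (suc d)

IsDist : {V : Set} → (V → V → Set) → V → V → ℕ → Set
IsDist R u v d = Walk R u v d × (∀ d′ → Walk R u v d′ → d ≤ d′)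

Connected : ∀ {m} → SimpleGraph m → Set
Connected {m} G = (x y : Fin m) → ∃ λ d → Walk (SimpleGraph.Adj G) x y d

-- Non-leaping sequences q_1,…,q_n  (q given as a function ℕ → ℕ, only
-- the values at 1..n matter)

NonLeaping : ℕ → (ℕ → ℕ) → Set
NonLeaping n q =
  2 ≤ n × q 1 ≡ 0 × q 2 ≡ 1 ×
  (∀ k → 3 ≤ k → k ≤ n → 2 ≤ q k × q k ≤ q (k ∸ 1) + 1)

bseq : (ℕ → ℕ) → ℕ → ℕ
bseq q k = suc k ∸ q k

InW : (ℕ → ℕ) → (ℕ → ℕ) → ℕ → ℕ → Set
InW q a zero i = ⊥
InW q a (suc zero) i = ⊥
InW q a (suc (suc zero)) i = i ≡ 1
InW q a k@(suc (suc (suc _))) i = i ≡ a k ⊎ (bseq q k ≤ i × i < k)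

-- a : ℕ → ℕ (values a_k, k = 3..n) defines a neighborhood sequence for s = q.
NeighborhoodSeq : ℕ → (ℕ → ℕ) → (ℕ → ℕ) → Set
NeighborhoodSeq n q a =
  ∀ k → 3 ≤ k → k ≤ n → InW q a (k ∸ 1) (a k) × a k < bseq q k

-- Adjacency of the graph in CP(s) determined by a: vertices 1..n,
-- edges {i,k} with i ∈ W_k (k ≤ n).
CPAdj : ℕ → (ℕ → ℕ) → (ℕ → ℕ) → ℕ → ℕ → Set
CPAdj n q a i j = (j ≤ n × InW q a j i) ⊎ (i ≤ n × InW q a i j)

-- Gluing G₀ ⊕_e G: vertices are Fin m (for G₀) plus ℕ (for vertices k ≥ 3
-- of G); vertex 1 of G is identified with v₁, vertex 2 with v₂.

GlueV : ℕ → Set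
GlueV m = Fin m ⊎ ℕ

emb : ∀ {m} → Fin m → Fin m → ℕ → GlueV m
emb v₁ v₂ 1 = inj₁ v₁
emb v₁ v₂ 2 = inj₁ v₂
emb v₁ v₂ k = inj₂ k

GlueAdj : ∀ {m} → SimpleGraph m → Fin m → Fin m →
          ℕ → (ℕ → ℕ) → (ℕ → ℕ) → GlueV m → GlueV m → Set
GlueAdj {m} G₀ v₁ v₂ n q a u w =
  (Σ (Fin m) λ x → Σ (Fin m) λ y →
     u ≡ inj₁ x × w ≡ inj₁ y × SimpleGraph.Adj G₀ x y)
  ⊎ (Σ ℕ λ i → Σ ℕ λ j →
     CPAdj n q a i j × emb v₁ v₂ i ≡ u × emb v₁ v₂ j ≡ w)

-- A vertex k ≥ 4 of G adjacent to both 1 and 2 has 1, 2 ∈ W_k, so b_k ≤ 2. Since b is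
-- nondecreasing, also b_{k-1} ≤ 2; together with 1 ≤ a_{k-1} < b_{k-1} this forces
-- W_{k-1} ∋ 1, 2, so k - 1 is adjacent to 1 and 2 as well. In G₀ ⊕_e G every walk from a
-- vertex of G₀ into G first reaches v₁ or v₂, from where both k and k - 1 are one step
-- away; hence each of k, k - 1 is at most as far from x as the other.
module Submission where

open import Defs
open import Data.Nat using (ℕ; zero; suc; _+_; _∸_; _≤_; _<_; z≤n; s≤s)
open import Data.Nat.Properties
open import Data.Fin using (Fin)
open import Data.Sum using (_⊎_; inj₁; inj₂)
open import Data.Product using (_×_; _,_; proj₁; proj₂; ∃-syntax)
open import Data.Empty using (⊥-elim)
open import Relation.Binary.PropositionalEquality using (_≡_; _≢_; refl; sym; cong; subst)
open import Function.Bundles using (_⇔_; mk⇔)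

CPAdj⇒InW : ∀ {n q a i} t → i ≤ 2 → CPAdj n q a i (3 + t) → InW q a (3 + t) i
CPAdj⇒InW t _ (inj₁ (_ , i∈W)) = i∈W
CPAdj⇒InW t (s≤s (s≤s z≤n)) (inj₂ (_ , ()))

InW-pair⇒bseq≤ : ∀ {q a i j} t → i < j →
  InW q a (3 + t) i → InW q a (3 + t) j → bseq q (3 + t) ≤ j
InW-pair⇒bseq≤ t _ _ (inj₂ (b≤j , _)) = b≤j
InW-pair⇒bseq≤ t i<j (inj₂ (b≤i , _)) (inj₁ _) = ≤-trans b≤i (<⇒≤ i<j)
InW-pair⇒bseq≤ t i<j (inj₁ refl) (inj₁ refl) = ⊥-elim (<-irrefl refl i<j)

module NonLeapingProperties {n q} (nl : NonLeaping n q) where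

  private
    q-step : ∀ k → 3 ≤ k → k ≤ n → q k ≤ q (k ∸ 1) + 1
    q-step k 3≤k k≤n = proj₂ (proj₂ (proj₂ (proj₂ nl)) k 3≤k k≤n)

  q<index : ∀ t → 2 + t ≤ n → q (2 + t) < 2 + t
  q<index zero _ = ≤-reflexive (cong suc (proj₁ (proj₂ (proj₂ nl))))
  q<index (suc t) h = begin-strict
    q (3 + t)          ≤⟨ q-step (3 + t) (s≤s (s≤s (s≤s z≤n))) h ⟩
    q (2 + t) + 1      ≡⟨ +-comm (q (2 + t)) 1 ⟩
    suc (q (2 + t))    <⟨ s≤s (q<index t (≤-trans (n≤1+n _) h)) ⟩
    3 + t              ∎
    where open ≤-Reasoning

  bseq-positive : ∀ t → 2 + t ≤ n → 0 < bseq q (2 + t)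
  bseq-positive t h = m<n⇒0<n∸m (m<n⇒m<1+n (q<index t h))

  bseq-mono : ∀ j → 3 ≤ suc j → suc j ≤ n → bseq q j ≤ bseq q (suc j)
  bseq-mono j 3≤ ≤n = begin
    suc j ∸ q j                ≡⟨ cong (suc (suc j) ∸_) (+-comm 1 (q j)) ⟩
    suc (suc j) ∸ (q j + 1)    ≤⟨ ∸-monoʳ-≤ (suc (suc j)) (q-step (suc j) 3≤ ≤n) ⟩
    suc (suc j) ∸ q (suc j)    ∎
    where open ≤-Reasoning

module NeighborhoodSeqProperties {n q a} (nl : NonLeaping n q) (ns : NeighborhoodSeq n q a) where
  open NonLeapingProperties nl

  InW-positive : ∀ {i} t → 2 + t ≤ n → InW q a (2 + t) i → 0 < i
  InW-positive zero _ refl = s≤s z≤n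
  InW-positive (suc t) h (inj₁ refl) =
    InW-positive t (≤-trans (n≤1+n _) h) (proj₁ (ns (3 + t) (s≤s (s≤s (s≤s z≤n))) h))
  InW-positive (suc t) h (inj₂ (b≤i , _)) = <-≤-trans (bseq-positive (suc t) h) b≤i

  bseq≤2⇒adj-1,2 : ∀ t → 3 + t ≤ n → bseq q (3 + t) ≤ 2 →
    CPAdj n q a 1 (3 + t) × CPAdj n q a 2 (3 + t)
  bseq≤2⇒adj-1,2 t h b≤2 with ns (3 + t) (s≤s (s≤s (s≤s z≤n))) h
  ... | a∈W , a<b = inj₁ (h , inj₁ (sym a≡1)) , inj₁ (h , inj₂ (b≤2 , s≤s (s≤s (s≤s z≤n))))
    where
    a≡1 : a (3 + t) ≡ 1
    a≡1 = ≤-antisym (≤-pred (<-≤-trans a<b b≤2)) (InW-positive t (≤-trans (n≤1+n _) h) a∈W)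

  common-neighbour-pred : ∀ t → 4 + t ≤ n →
    CPAdj n q a 1 (4 + t) → CPAdj n q a 2 (4 + t) →
    CPAdj n q a 1 (3 + t) × CPAdj n q a 2 (3 + t)
  common-neighbour-pred t h adj₁ adj₂ =
    bseq≤2⇒adj-1,2 t (≤-trans (n≤1+n _) h) (≤-trans bₖ₋₁≤bₖ bₖ≤2)
    where
    bₖ≤2 : bseq q (4 + t) ≤ 2
    bₖ≤2 = InW-pair⇒bseq≤ {q} {a} (suc t) ≤-refl
      (CPAdj⇒InW {n} {q} {a} (suc t) (n≤1+n 1) adj₁) (CPAdj⇒InW {n} {q} {a} (suc t) ≤-refl adj₂)
    bₖ₋₁≤bₖ : bseq q (3 + t) ≤ bseq q (4 + t)
    bₖ₋₁≤bₖ = bseq-mono (3 + t) (s≤s (s≤s (s≤s z≤n))) h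

_∷ʳ_ : ∀ {V : Set} {R : V → V → Set} {u v w d} → Walk R u v d → R v w → Walk R u w (suc d)
[] ∷ʳ r = r ∷ []
(s ∷ p) ∷ʳ r = s ∷ (p ∷ʳ r)

NoFarther : {V : Set} → (V → V → Set) → V → V → V → Set
NoFarther R u w v = ∀ {d} → Walk R u v d → ∃[ d′ ] d′ ≤ d × Walk R u w d′

module _ {V : Set} {R : V → V → Set} where

  NoFarther⇒IsDist : ∀ {u v w} → NoFarther R u w v → NoFarther R u v w →
    ∀ {d} → IsDist R u v d → IsDist R u w d
  NoFarther⇒IsDist {u} {v} {w} w≼v v≼w {d} (walk , minimal) with w≼v walk
  ... | d′ , d′≤d , walk′ with v≼w walk′
  ... | d″ , d″≤d′ , walk″ =
    subst (Walk R u w) (≤-antisym d′≤d (≤-trans (minimal d″ walk″) d″≤d′)) walk′ , minimal′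
    where
    minimal′ : ∀ e → Walk R u w e → d ≤ e
    minimal′ e p with v≼w p
    ... | e′ , e′≤e , p′ = ≤-trans (minimal e′ p′) e′≤e

  NoFarther⇒IsDist-⇔ : ∀ {u v w} → NoFarther R u w v → NoFarther R u v w →
    ∀ d → IsDist R u v d ⇔ IsDist R u w d
  NoFarther⇒IsDist-⇔ w≼v v≼w d = mk⇔ (NoFarther⇒IsDist w≼v v≼w) (NoFarther⇒IsDist v≼w w≼v)

module Glued {m} (G₀ : SimpleGraph m) (v₁ v₂ : Fin m) (n : ℕ) (q a : ℕ → ℕ) where

  private
    R : GlueV m → GlueV m → Set
    R = GlueAdj G₀ v₁ v₂ n q a

  reaches-v₁-or-v₂-first : ∀ {y j d} → Walk R (inj₁ y) (inj₂ j) d →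
    ∃[ e ] e < d × (Walk R (inj₁ y) (inj₁ v₁) e ⊎ Walk R (inj₁ y) (inj₁ v₂) e)
  reaches-v₁-or-v₂-first (_∷_ {v = inj₁ _} r p) with reaches-v₁-or-v₂-first p
  ... | e , e<d , inj₁ p′ = suc e , s≤s e<d , inj₁ (r ∷ p′)
  ... | e , e<d , inj₂ p′ = suc e , s≤s e<d , inj₂ (r ∷ p′)
  reaches-v₁-or-v₂-first (_∷_ {v = inj₂ _} (inj₁ (_ , _ , _ , () , _)) _)
  reaches-v₁-or-v₂-first (_∷_ {v = inj₂ _} (inj₂ (1 , _ , _ , refl , _)) _) = 0 , s≤s z≤n , inj₁ []
  reaches-v₁-or-v₂-first (_∷_ {v = inj₂ _} (inj₂ (2 , _ , _ , refl , _)) _) = 0 , s≤s z≤n , inj₂ []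

  common-neighbour-no-farther : ∀ {x j} t → CPAdj n q a 1 (3 + t) → CPAdj n q a 2 (3 + t) →
    NoFarther R (inj₁ x) (inj₂ (3 + t)) (inj₂ j)
  common-neighbour-no-farther t adj₁ adj₂ p with reaches-v₁-or-v₂-first p
  ... | e , e<d , inj₁ p′ = suc e , e<d , p′ ∷ʳ inj₂ (1 , 3 + t , adj₁ , refl , refl)
  ... | e , e<d , inj₂ p′ = suc e , e<d , p′ ∷ʳ inj₂ (2 , 3 + t , adj₂ , refl , refl)

lemma3p4 : ∀ {m} (G₀ : SimpleGraph m) (v₁ v₂ : Fin m) →
    Connected G₀ → SimpleGraph.Adj G₀ v₁ v₂ →
    (n : ℕ) (q : ℕ → ℕ) → NonLeaping n q →
    (a : ℕ → ℕ) → NeighborhoodSeq n q a →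
    (x : Fin m) → x ≢ v₁ → x ≢ v₂ →
    (k : ℕ) → 4 ≤ k → k ≤ n →
    CPAdj n q a 1 k → CPAdj n q a 2 k →
    (d : ℕ) →
    IsDist (GlueAdj G₀ v₁ v₂ n q a) (inj₁ x) (emb v₁ v₂ k) d
      ⇔ IsDist (GlueAdj G₀ v₁ v₂ n q a) (inj₁ x) (emb v₁ v₂ (k ∸ 1)) d
lemma3p4 G₀ v₁ v₂ _ _ n q nl a ns x _ _
         (suc (suc (suc (suc t)))) (s≤s (s≤s (s≤s (s≤s _)))) k≤n adj₁ adj₂
  with NeighborhoodSeqProperties.common-neighbour-pred nl ns t k≤n adj₁ adj₂
... | adj₁′ , adj₂′ =
  NoFarther⇒IsDist-⇔ (common-neighbour-no-farther t adj₁′ adj₂′)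
                     (common-neighbour-no-farther (suc t) adj₁ adj₂)
  where open Glued G₀ v₁ v₂ n q a
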